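{- For every integer $q \geq 2$ and every $q$-palette $C$ over a field $\mathbb{F}$, there exists a polynomial $g : \mathbb{F}^{q \times (q-1)} \to \mathbb{F}$ of degree $q-2$ in the $q(q-1)$ variables corresponding to the entries of a $q \times (q-1)$ matrix, such that for every $C$-colored matrix $M = (a_1, \ldots, a_{q-1}) \in \mathbb{F}^{q \times (q-1)}$ we have $g(M) = 0$ if and only if there exist distinct $i, j \in \{1,\ldots,q-1\}$ with $a_i = a_j$.
   Context: For an integer $q \geq 2$ and a field $\mathbb{F}$, a $q$-palette over $\mathbb{F}$ is a set $C = \{c_1, \ldots, c_q\}$ of $q$ vectors in $\mathbb{F}^q$ such that: (1) the first entry of each $c_i$ is $1$; (2) $C$ is linearly independent over $\mathbb{F}$; and (3) for every $S \subseteq \{1,\ldots,q\}$ with $|S| = q-1$, the vectors in $\mathbb{F}^{q-1}$ obtained from $c_i$, $i \in S$, by omitting their last entry are linearly independent over $\mathbb{F}$. A matrix $M = (a_1, \ldots, a_m) \in \mathbb{F}^{q \times m}$ (with columns $a_1,\ldots,a_m$) is $C$-colored if $a_i \in C$ for all $i$. -}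

module Defs where

open import Level using (Level; _⊔_) renaming (suc to lsuc)
open import Algebra.Bundles using (CommutativeRing)
open import Data.Nat using (ℕ; zero; suc; _≤_) renaming (_+_ to _+ℕ_)
open import Data.Fin using (Fin; zero; suc; punchIn; inject₁)
open import Data.List using (List; []; _∷_)
open import Data.List.Relation.Unary.All using (All)
open import Data.List.Relation.Unary.Any using (Any)
open import Data.List.Relation.Unary.AllPairs using (AllPairs)
open import Data.Product using (Σ; ∃; _×_; _,_; proj₁; proj₂)
open import Relation.Nullary using (¬_)
open import Relation.Binary.PropositionalEquality using (_≡_)

record Field (c ℓ : Level) : Set (lsuc (c ⊔ ℓ)) where
  field
    commutativeRing : CommutativeRing c ℓ
  open CommutativeRing commutativeRing public
  field
    0≉1     : ¬ (0# ≈ 1#)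
    inverse : ∀ x → ¬ (x ≈ 0#) → ∃ λ y → (x * y) ≈ 1#

sumℕ : ∀ {m} → (Fin m → ℕ) → ℕ
sumℕ {zero}  f = 0
sumℕ {suc m} f = f zero +ℕ sumℕ (λ i → f (suc i))

module _ {c ℓ} (F : Field c ℓ) where
  open Field F using (Carrier; _≈_; _+_; _*_; 0#; 1#)

  Σᶠ : ∀ {m} → (Fin m → Carrier) → Carrier
  Σᶠ {zero}  f = 0#
  Σᶠ {suc m} f = f zero + Σᶠ (λ i → f (suc i))

  Πᶠ : ∀ {m} → (Fin m → Carrier) → Carrier
  Πᶠ {zero}  f = 1#
  Πᶠ {suc m} f = f zero * Πᶠ (λ i → f (suc i))

  pow : Carrier → ℕ → Carrier
  pow x zero    = 1#
  pow x (suc k) = x * pow x k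

  LinIndep : ∀ {m d} → (Fin m → Fin d → Carrier) → Set (c ⊔ ℓ)
  LinIndep {m} {d} v =
    (λs : Fin m → Carrier) →
    (∀ (j : Fin d) → Σᶠ (λ i → λs i * v i j) ≈ 0#) →
    ∀ (i : Fin m) → λs i ≈ 0#

  dropLast : ∀ {n} → (Fin (suc n) → Carrier) → (Fin n → Carrier)
  dropLast v j = v (inject₁ j)

  -- q-palettes, with q = suc n.  The palette C = {c₁,…,c_q} is given as
  -- an indexed family c : Fin q → F^q (linear independence forces the
  -- c_i to be distinct, so this is a set of q vectors).  The subsets S
  -- of {1..q} of size q-1 are exactly the complements of single indices
  -- k, enumerated by punchIn k : Fin (q-1) → Fin q.

  IsPalette : ∀ {n} → (Fin (suc n) → Fin (suc n) → Carrier) → Set (c ⊔ ℓ)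
  IsPalette {n} cs =
    (∀ i → cs i zero ≈ 1#) ×
    LinIndep cs ×
    (∀ (k : Fin (suc n)) → LinIndep (λ (i : Fin n) → dropLast (cs (punchIn k i))))

  column : ∀ {r m} → (Fin r → Fin m → Carrier) → Fin m → Fin r → Carrier
  column M j r = M r j

  _≈ᵛ_ : ∀ {d} → (Fin d → Carrier) → (Fin d → Carrier) → Set ℓ
  u ≈ᵛ v = ∀ r → u r ≈ v r

  Colored : ∀ {q m} → (Fin q → Fin q → Carrier) → (Fin q → Fin m → Carrier) → Set ℓ
  Colored cs M = ∀ j → ∃ λ i → column M j ≈ᵛ cs i

  -- Polynomials over F in the variables x_{r,j} (r : Fin R, j : Fin m),
  -- the entries of an R × m matrix, in canonical sparse form: a list of
  -- terms (coefficient, exponent matrix) with all coefficients nonzero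
  -- and pairwise distinct exponent matrices.

  Exponent : ℕ → ℕ → Set
  Exponent R m = Fin R → Fin m → ℕ

  Term : ℕ → ℕ → Set c
  Term R m = Carrier × Exponent R m

  SameExponent : ∀ {R m} → Exponent R m → Exponent R m → Set
  SameExponent e e' = ∀ r j → e r j ≡ e' r j

  record Polynomial (R m : ℕ) : Set (c ⊔ ℓ) where
    field
      terms       : List (Term R m)
      nonzeroCoef : All (λ t → ¬ (proj₁ t ≈ 0#)) terms
      distinctExp : AllPairs (λ t t' → ¬ SameExponent (proj₂ t) (proj₂ t')) terms

  open Polynomial public

  monDeg : ∀ {R m} → Exponent R m → ℕ
  monDeg e = sumℕ (λ r → sumℕ (λ j → e r j))

  -- The (total) degree of p is exactly d: every term has degree ≤ d and
  -- some term has degree d.  (The zero polynomial has no degree.)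
  HasDegree : ∀ {R m} → Polynomial R m → ℕ → Set c
  HasDegree p d =
    All (λ t → monDeg (proj₂ t) ≤ d) (terms p) ×
    Any (λ t → monDeg (proj₂ t) ≡ d) (terms p)

  evalMon : ∀ {R m} → Exponent R m → (Fin R → Fin m → Carrier) → Carrier
  evalMon e M = Πᶠ (λ r → Πᶠ (λ j → pow (M r j) (e r j)))

  evalTerms : ∀ {R m} → List (Term R m) → (Fin R → Fin m → Carrier) → Carrier
  evalTerms []             M = 0#
  evalTerms ((a , e) ∷ ts) M = a * evalMon e M + evalTerms ts M

  eval : ∀ {R m} → Polynomial R m → (Fin R → Fin m → Carrier) → Carrier
  eval p M = evalTerms (terms p) M

module Submission where

-- Let g(M) be the determinant of the square matrix whose j-th column is the j-th column of M with its
-- first entry replaced by 1 and its last entry dropped. Expanding along the row of ones writes g as a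
-- signed sum of products of q-2 entries of M, one for each way of matching the remaining rows with
-- distinct columns, and these monomials are pairwise distinct, so g has degree q-2.
-- If two columns of M are equal, g(M) = 0 because the determinant is alternating. If M is C-coloured
-- with pairwise distinct colours, its q-1 columns miss exactly one colour, so by axiom (3) of a palette
-- the truncated columns are linearly independent and the determinant does not vanish. As equality in
-- a field need not be decidable, this last step is Gaussian elimination carried out under a double
-- negation.

open import Level using (Level; _⊔_)
open import Algebra.Bundles using (CommutativeMonoid)
open import Data.Bool using (if_then_else_)
open import Data.Empty using (⊥; ⊥-elim)
open import Data.Fin as Fin using (Fin; zero; suc; punchIn; punchOut; inject₁; toℕ)
open import Data.Fin.Properties
  using ( punchInᵢ≢i; punchIn-injective; punchIn-punchOut; punchOut-injective; suc-injective
        ; inject₁-injective; toℕ-inject₁; toℕ-injective; toℕ<n; toℕ-fromℕ<; <-cmp; <⇒≢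
        ; any?; ¬∀⟶∃¬; <⇒notInjective; ∀-cons )
  renaming (_≟_ to _≟ᶠ_)
open import Data.List using (List; []; _∷_; _++_; map; concat; tabulate)
open import Data.List.Relation.Unary.All as All using (All)
import Data.List.Relation.Unary.All.Properties as All
open import Data.List.Relation.Unary.AllPairs as AllPairs using (AllPairs)
import Data.List.Relation.Unary.AllPairs.Properties as AllPairs
import Data.List.Relation.Unary.Any as Any
import Data.List.Relation.Unary.Any.Properties as Any
open import Data.Nat using (ℕ; zero; suc; _≤_)
import Data.Nat as ℕ
import Data.Nat.Properties as ℕ
open import Data.Product using (∃; ∃₂; _×_; _,_; proj₁; proj₂)
open import Data.Product.Properties using (≡-dec; ×-≡,≡←≡)
open import Data.Sum using (_⊎_; inj₁; inj₂)
open import Data.Vec.Functional using (Vector; removeAt; updateAt; insertAt; zipWith)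
open import Data.Vec.Functional.Properties
  using (updateAt-updates; updateAt-minimal; insertAt-lookup; insertAt-punchIn)
open import Function using (_∘_; _on_; id; const)
open import Function.Bundles using (_⇔_; mk⇔)
open import Function.Definitions using (Injective)
open import Relation.Binary.Core using (Rel)
open import Relation.Binary.Definitions using (tri<; tri≈; tri>)
open import Relation.Binary.PropositionalEquality as ≡ using (_≡_; _≢_)
open import Relation.Nullary using (¬_; yes; no)
open import Relation.Nullary.Decidable using (does; dec-true; dec-false; ¬?; _×-dec_)
open import Relation.Nullary.Negation using (contradiction)

open import Defs

punchIn-inject₁-self : ∀ {n} (c : Fin n) → punchIn (inject₁ c) c ≡ suc c
punchIn-inject₁-self zero    = ≡.refl
punchIn-inject₁-self (suc c) = ≡.cong suc (punchIn-inject₁-self c)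

punchIn-suc-self : ∀ {n} (c : Fin n) → punchIn (suc c) c ≡ inject₁ c
punchIn-suc-self zero    = ≡.refl
punchIn-suc-self (suc c) = ≡.cong suc (punchIn-suc-self c)

punchIn-adjacent : ∀ {n} (c x : Fin n) → x ≢ c → punchIn (inject₁ c) x ≡ punchIn (suc c) x
punchIn-adjacent zero    zero    x≢c = contradiction ≡.refl x≢c
punchIn-adjacent zero    (suc x) _   = ≡.refl
punchIn-adjacent (suc c) zero    _   = ≡.refl
punchIn-adjacent (suc c) (suc x) x≢c = ≡.cong suc (punchIn-adjacent c x (x≢c ∘ ≡.cong suc))

punchOut-adjacent : ∀ {n} (i : Fin (suc (suc n))) (c : Fin (suc n)) → i ≢ inject₁ c → i ≢ suc c →
                    ∃ λ c′ → punchIn i (inject₁ c′) ≡ inject₁ c × punchIn i (suc c′) ≡ suc c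
punchOut-adjacent zero          zero    i≢c _     = contradiction ≡.refl i≢c
punchOut-adjacent zero          (suc c) _   _     = c , ≡.refl , ≡.refl
punchOut-adjacent (suc zero)    zero    _   i≢c+1 = contradiction ≡.refl i≢c+1
punchOut-adjacent {suc n} (suc (suc i)) zero _ _  = zero , ≡.refl , ≡.refl
punchOut-adjacent {suc n} (suc i) (suc c) i≢c i≢c+1
  with c′ , e₁ , e₂ ← punchOut-adjacent i c (i≢c ∘ ≡.cong suc) (i≢c+1 ∘ ≡.cong suc)
  = suc c′ , ≡.cong suc e₁ , ≡.cong suc e₂

punchIn-cases : ∀ {n p} {P : Fin (suc n) → Set p} (k : Fin (suc n)) →
                P k → (∀ j → P (punchIn k j)) → ∀ i → P i
punchIn-cases {P = P} k Pk P∘punchIn i with i ≟ᶠ k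
... | yes ≡.refl = Pk
... | no  i≢k  = ≡.subst P (punchIn-punchOut (i≢k ∘ ≡.sym)) (P∘punchIn _)

¬¬-∀-Fin : ∀ {n p} {P : Fin n → Set p} → (∀ i → ¬ ¬ P i) → ¬ ¬ (∀ i → P i)
¬¬-∀-Fin {zero}  _    ¬∀ = ¬∀ (λ ())
¬¬-∀-Fin {suc n} ¬¬P ¬∀ = ¬¬P zero λ P₀ → ¬¬-∀-Fin (¬¬P ∘ suc) (¬∀ ∘ ∀-cons P₀)

collision-or-injective : ∀ {m n} (f : Fin m → Fin n) →
                         (∃₂ λ i j → i ≢ j × f i ≡ f j) ⊎ Injective _≡_ _≡_ f
collision-or-injective f with any? (λ i → any? λ j → ¬? (i ≟ᶠ j) ×-dec (f i ≟ᶠ f j))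
... | yes collision   = inj₁ collision
... | no  ¬collision = inj₂ injective
  where
  injective : Injective _≡_ _≡_ f
  injective {i} {j} fi≡fj with i ≟ᶠ j
  ... | yes i≡j = i≡j
  ... | no  i≢j = contradiction (i , j , i≢j , fi≡fj) ¬collision

punchIn-factorisation : ∀ {m} (f : Fin m → Fin (suc m)) → Injective _≡_ _≡_ f →
                        ∃₂ λ k (π : Fin m → Fin m) →
                          Injective _≡_ _≡_ π × (∀ j → punchIn k (π j) ≡ f j)
punchIn-factorisation {m} f f-inj = k , π , π-inj , λ j → punchIn-punchOut (k≢f j)
  where
  not-onto : ¬ (∀ k → ∃ λ j → f j ≡ k)
  not-onto onto = <⇒notInjective {f = section} (ℕ.n<1+n m) section-inj
    where
    section : Fin (suc m) → Fin m
    section k = proj₁ (onto k)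
    section-inj : Injective _≡_ _≡_ section
    section-inj {k} {k′} eq =
      ≡.trans (≡.sym (proj₂ (onto k))) (≡.trans (≡.cong f eq) (proj₂ (onto k′)))
  missed : ∃ λ k → ¬ (∃ λ j → f j ≡ k)
  missed = ¬∀⟶∃¬ (suc m) _ (λ k → any? λ j → f j ≟ᶠ k) not-onto
  k = proj₁ missed
  k≢f : ∀ j → k ≢ f j
  k≢f j k≡fj = proj₂ missed (j , ≡.sym k≡fj)
  π : Fin m → Fin m
  π j = punchOut (k≢f j)
  π-inj : Injective _≡_ _≡_ π
  π-inj eq = f-inj (punchOut-injective (k≢f _) (k≢f _) eq)

AllPairs-concat-tabulate : ∀ {a r q k} {A : Set a} {R : Rel A r} (Q : Fin k → A → Set q)
                           {blocks : Fin k → List A} →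
                           (∀ j → AllPairs R (blocks j)) → (∀ j → All (Q j) (blocks j)) →
                           (∀ {i j x y} → i ≢ j → Q i x → Q j y → R x y) →
                           AllPairs R (concat (tabulate blocks))
AllPairs-concat-tabulate Q within labelled separated =
  AllPairs.concat⁺ (All.tabulate⁺ within)
    (AllPairs.tabulate⁺ λ i≢j → All.map (λ qx → All.map (separated i≢j qx) (labelled _)) (labelled _))

module MonoidSums {a ℓ} (M : CommutativeMonoid a ℓ) where
  open CommutativeMonoid M
  open import Algebra.Properties.CommutativeMonoid.Sum M public
  open import Relation.Binary.Reasoning.Setoid setoid

  sum-zero : ∀ {n} (f : Vector Carrier n) → (∀ i → f i ≈ ε) → sum f ≈ ε
  sum-zero {n} f f≈ε = trans (sum-cong-≋ f≈ε) (sum-replicate-zero n)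

  sum-single : ∀ {n} (f : Vector Carrier (suc n)) i → (∀ j → f (punchIn i j) ≈ ε) → sum f ≈ f i
  sum-single f i rest≈ε = begin
    sum f                     ≈⟨ sum-remove f ⟩
    f i ∙ sum (removeAt f i)  ≈⟨ ∙-congˡ (sum-zero _ rest≈ε) ⟩
    f i ∙ ε                   ≈⟨ identityʳ _ ⟩
    f i                       ∎

  sum-pair : ∀ {n} (f : Vector Carrier (suc (suc n))) i j →
             (∀ l → f (punchIn i (punchIn j l)) ≈ ε) → sum f ≈ f i ∙ f (punchIn i j)
  sum-pair f i j rest≈ε = trans (sum-remove f) (∙-congˡ (sum-single (removeAt f i) j rest≈ε))

  ∑∑-distrib : ∀ {m n} (f g : Fin m → Fin n → Carrier) →
               sum (λ r → sum λ c → f r c ∙ g r c) ≈ sum (λ r → sum (f r)) ∙ sum (λ r → sum (g r))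
  ∑∑-distrib {m} {n} f g =
    trans (sum-cong-≋ λ r → ∑-distrib-+ {n} (f r) (g r))
          (∑-distrib-+ {m} (λ r → sum (f r)) (λ r → sum (g r)))

  ∑∑-single : ∀ {m n} (f : Fin (suc m) → Fin (suc n) → Carrier) r c →
              (∀ r′ c′ → f (punchIn r r′) c′ ≈ ε) → (∀ c′ → f r (punchIn c c′) ≈ ε) →
              sum (λ r′ → sum (f r′)) ≈ f r c
  ∑∑-single f r c other-rows other-columns =
    trans (sum-single (λ r′ → sum (f r′)) r λ r′ → sum-zero (f (punchIn r r′)) (other-rows r′))
          (sum-single (f r) c other-columns)

module Determinants {c ℓ} (F : Field c ℓ) where
  open Field F hiding (zero)
  open import Algebra.Properties.Ring ring using (-‿involutive; -0#≈0#; -‿distribˡ-*; +-inverseʳ-unique)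
  open import Algebra.Properties.Semiring.Sum semiring using (*-distribˡ-sum)
  open import Algebra.Solver.Ring.NaturalCoefficients.Default commutativeSemiring using (solve; _:=_; _:+_; _:*_)
  open import Data.Vec.Functional.Relation.Binary.Equality.Setoid setoid using (_≋_)
  open import Relation.Binary.Reasoning.Setoid setoid
  open MonoidSums +-commutativeMonoid

  1≉0 : ¬ 1# ≈ 0#
  1≉0 = 0≉1 ∘ sym

  -x≈0⇒x≈0 : ∀ {x} → - x ≈ 0# → x ≈ 0#
  -x≈0⇒x≈0 {x} -x≈0 = trans (sym (-‿involutive x)) (trans (-‿cong -x≈0) -0#≈0#)

  x*y≈1⇒x*z≈0⇒z≈0 : ∀ {x y z} → x * y ≈ 1# → x * z ≈ 0# → z ≈ 0#
  x*y≈1⇒x*z≈0⇒z≈0 {x} {y} {z} xy≈1 xz≈0 = begin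
    z             ≈⟨ *-identityˡ z ⟨
    1# * z        ≈⟨ *-congʳ (trans (sym xy≈1) (*-comm x y)) ⟩
    y * x * z     ≈⟨ *-assoc y x z ⟩
    y * (x * z)   ≈⟨ *-congˡ xz≈0 ⟩
    y * 0#        ≈⟨ zeroʳ y ⟩
    0#            ∎

  ≡⇒≋ : ∀ {N} {x y : Fin N → Carrier} → x ≡ y → x ≋ y
  ≡⇒≋ x≡y r = reflexive (≡.cong-app x≡y r)

  sign : ℕ → Carrier
  sign zero    = 1#
  sign (suc k) = - sign k

  sign*x≈0⇒x≈0 : ∀ k {x} → sign k * x ≈ 0# → x ≈ 0#
  sign*x≈0⇒x≈0 zero    {x} 1x≈0  = trans (sym (*-identityˡ x)) 1x≈0
  sign*x≈0⇒x≈0 (suc k) {x} -sx≈0 =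
    sign*x≈0⇒x≈0 k (-x≈0⇒x≈0 (trans (-‿distribˡ-* (sign k) x) -sx≈0))

  Family : ℕ → ℕ → Set c
  Family m N = Fin m → Fin N → Carrier

  tails : ∀ {m N} → Family m (suc N) → Family m N
  tails v i r = v i (suc r)

  minor : ∀ {n} → Family (suc n) (suc n) → Fin (suc n) → Family n n
  minor v j = tails (removeAt v j)

  det : ∀ {n} → Family n n → Carrier
  det {zero}  v = 1#
  det {suc n} v = sum λ j → sign (toℕ j) * (v j zero * det (minor v j))

  det-cong : ∀ {n} {v w : Family n n} → (∀ i → v i ≋ w i) → det v ≈ det w
  det-cong {zero}  v≋w = refl
  det-cong {suc n} v≋w = sum-cong-≋ λ j →
    *-congˡ {sign (toℕ j)} (*-cong (v≋w j zero) (det-cong λ i r → v≋w (punchIn j i) (suc r)))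

  det-linear : ∀ {n} (u v w : Family n n) j t →
               u j ≋ (λ r → v j r + t * w j r) →
               (∀ i → i ≢ j → u i ≋ v i) → (∀ i → i ≢ j → u i ≋ w i) →
               det u ≈ det v + t * det w
  det-linear {suc n} u v w j t uj≋vj+twj u≋v u≋w = begin
    sum (term u)                          ≈⟨ sum-cong-≋ split ⟩
    sum (λ i → term v i + t * term w i)   ≈⟨ ∑-distrib-+ {suc n} (term v) (λ i → t * term w i) ⟩
    det v + sum (λ i → t * term w i)      ≈⟨ +-congˡ (*-distribˡ-sum t (term w)) ⟨
    det v + t * det w                     ∎
    where
    term : Family (suc n) (suc n) → Fin (suc n) → Carrier
    term x i = sign (toℕ i) * (x i zero * det (minor x i))

    linear-head : ∀ s a b d → s * ((a + t * b) * d) ≈ s * (a * d) + t * (s * (b * d))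
    linear-head =
      solve 5 (λ t s a b d → s :* ((a :+ t :* b) :* d) := s :* (a :* d) :+ t :* (s :* (b :* d))) refl t

    linear-minor : ∀ s a x y → s * (a * (x + t * y)) ≈ s * (a * x) + t * (s * (a * y))
    linear-minor =
      solve 5 (λ t s a x y → s :* (a :* (x :+ t :* y)) := s :* (a :* x) :+ t :* (s :* (a :* y))) refl t

    split : ∀ i → term u i ≈ term v i + t * term w i
    split i with i ≟ᶠ j
    ... | yes ≡.refl = begin
      s * (u i zero * D)                              ≈⟨ *-congˡ {s} (*-congʳ (uj≋vj+twj zero)) ⟩
      s * ((v i zero + t * w i zero) * D)             ≈⟨ linear-head s _ _ _ ⟩
      s * (v i zero * D) + t * (s * (w i zero * D))
        ≈⟨ +-cong (*-congˡ {s} (*-congˡ (det-cong minor-u≋v)))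
                  (*-congˡ {t} (*-congˡ {s} (*-congˡ (det-cong minor-u≋w)))) ⟩
      term v i + t * term w i                         ∎
      where
      s = sign (toℕ i)
      D = det (minor u i)
      minor-u≋v : ∀ l → minor u i l ≋ minor v i l
      minor-u≋v l r = u≋v (punchIn i l) (punchInᵢ≢i i l) (suc r)
      minor-u≋w : ∀ l → minor u i l ≋ minor w i l
      minor-u≋w l r = u≋w (punchIn i l) (punchInᵢ≢i i l) (suc r)
    ... | no i≢j = begin
      s * (u i zero * det (minor u i))
        ≈⟨ *-congˡ {s} (*-congˡ minors-linear) ⟩
      s * (u i zero * (det (minor v i) + t * det (minor w i)))
        ≈⟨ linear-minor s _ _ _ ⟩
      s * (u i zero * det (minor v i)) + t * (s * (u i zero * det (minor w i)))
        ≈⟨ +-cong (*-congˡ {s} (*-congʳ (u≋v i i≢j zero)))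
                  (*-congˡ {t} (*-congˡ {s} (*-congʳ (u≋w i i≢j zero)))) ⟩
      term v i + t * term w i
        ∎
      where
      s = sign (toℕ i)
      j′ = punchOut i≢j
      j≡i,j′ : j ≡ punchIn i j′
      j≡i,j′ = ≡.sym (punchIn-punchOut i≢j)
      avoids-j : ∀ l → l ≢ j′ → punchIn i l ≢ j
      avoids-j l l≢j′ eq = l≢j′ (punchIn-injective i l j′ (≡.trans eq j≡i,j′))
      minors-linear : det (minor u i) ≈ det (minor v i) + t * det (minor w i)
      minors-linear = det-linear (minor u i) (minor v i) (minor w i) j′ t
        (≡.subst (λ x → tails u x ≋ λ r → tails v x r + t * tails w x r) j≡i,j′ (uj≋vj+twj ∘ suc))
        (λ l l≢j′ r → u≋v (punchIn i l) (avoids-j l l≢j′) (suc r))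
        (λ l l≢j′ r → u≋w (punchIn i l) (avoids-j l l≢j′) (suc r))

  det-additive : ∀ {n} (u v w : Family n n) j →
                 u j ≋ zipWith _+_ (v j) (w j) →
                 (∀ i → i ≢ j → u i ≋ v i) → (∀ i → i ≢ j → u i ≋ w i) →
                 det u ≈ det v + det w
  det-additive u v w j uj≋vj+wj u≋v u≋w = trans
    (det-linear u v w j 1# (λ r → trans (uj≋vj+wj r) (+-congˡ (sym (*-identityˡ _)))) u≋v u≋w)
    (+-congˡ (*-identityˡ _))

  det-adjacent-equal : ∀ {n} (v : Family (suc n) (suc n)) (c : Fin n) →
                       v (inject₁ c) ≋ v (suc c) → det v ≈ 0#
  det-adjacent-equal {suc n} v c va≋vb = begin
    det v                          ≈⟨ sum-pair term a c others ⟩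
    term a + term (punchIn a c)    ≡⟨ ≡.cong (λ i → term a + term i) (punchIn-inject₁-self c) ⟩
    term a + term b                ≈⟨ +-cong (*-congʳ (reflexive (≡.cong sign (toℕ-inject₁ c))))
                                             (*-congˡ {sign (toℕ b)}
                                               (*-cong (sym (va≋vb zero)) (sym (det-cong minors≋)))) ⟩
    s * X + - s * X                ≈⟨ +-congˡ (-‿distribˡ-* s X) ⟨
    s * X - s * X                  ≈⟨ -‿inverseʳ (s * X) ⟩
    0#                             ∎
    where
    a = inject₁ c
    b = suc c
    s = sign (toℕ c)
    X = v a zero * det (minor v a)
    term : Fin (suc (suc n)) → Carrier
    term i = sign (toℕ i) * (v i zero * det (minor v i))

    minors≋ : ∀ l → minor v a l ≋ minor v b l
    minors≋ l r with l ≟ᶠ c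
    ... | yes ≡.refl rewrite punchIn-inject₁-self c | punchIn-suc-self c = sym (va≋vb (suc r))
    ... | no  l≢c    rewrite punchIn-adjacent c l l≢c = refl

    vanishes : ∀ i → i ≢ a → i ≢ b → term i ≈ 0#
    vanishes i i≢a i≢b with c′ , i,c′≡a , i,c′+1≡b ← punchOut-adjacent i c i≢a i≢b =
      trans (*-congˡ {sign (toℕ i)} (trans (*-congˡ minor≈0) (zeroʳ _))) (zeroʳ _)
      where
      minor≈0 : det (minor v i) ≈ 0#
      minor≈0 = det-adjacent-equal (minor v i) c′ λ r →
        ≡.subst₂ (λ x y → v x (suc r) ≈ v y (suc r)) (≡.sym i,c′≡a) (≡.sym i,c′+1≡b) (va≋vb (suc r))

    others : ∀ l → term (punchIn a (punchIn c l)) ≈ 0#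
    others l = vanishes (punchIn a (punchIn c l)) (punchInᵢ≢i a _) λ eq →
      punchInᵢ≢i c l (punchIn-injective a _ c (≡.trans eq (≡.sym (punchIn-inject₁-self c))))

  setAdjacent : ∀ {n N} → Family (suc n) N → Fin n → (x y : Fin N → Carrier) → Family (suc n) N
  setAdjacent v c x y = updateAt (updateAt v (suc c) (const y)) (inject₁ c) (const x)

  module _ {n N} (v : Family (suc n) N) (c : Fin n) where

    private
      suc≢inject₁ : suc c ≢ inject₁ c
      suc≢inject₁ eq = ℕ.1+n≢n (≡.trans (≡.cong toℕ eq) (toℕ-inject₁ c))

    setAdjacent-inject₁ : ∀ x y → setAdjacent v c x y (inject₁ c) ≡ x
    setAdjacent-inject₁ x y = updateAt-updates (inject₁ c) _

    setAdjacent-suc : ∀ x y → setAdjacent v c x y (suc c) ≡ y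
    setAdjacent-suc x y =
      ≡.trans (updateAt-minimal (suc c) (inject₁ c) _ suc≢inject₁) (updateAt-updates (suc c) v)

    setAdjacent-other : ∀ x y i → i ≢ inject₁ c → i ≢ suc c → setAdjacent v c x y i ≡ v i
    setAdjacent-other x y i i≢a i≢b =
      ≡.trans (updateAt-minimal i (inject₁ c) _ i≢a) (updateAt-minimal i (suc c) v i≢b)

    setAdjacent-self : ∀ i → setAdjacent v c (v (inject₁ c)) (v (suc c)) i ≡ v i
    setAdjacent-self i with i ≟ᶠ inject₁ c | i ≟ᶠ suc c
    ... | yes ≡.refl | _          = setAdjacent-inject₁ _ _
    ... | no  _      | yes ≡.refl = setAdjacent-suc _ _
    ... | no  i≢a    | no  i≢b    = setAdjacent-other _ _ i i≢a i≢b

    setAdjacent-≢inject₁ : ∀ x x′ y i → i ≢ inject₁ c →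
                           setAdjacent v c x y i ≡ setAdjacent v c x′ y i
    setAdjacent-≢inject₁ x x′ y i i≢a =
      ≡.trans (updateAt-minimal i (inject₁ c) _ i≢a) (≡.sym (updateAt-minimal i (inject₁ c) _ i≢a))

    setAdjacent-≢suc : ∀ x y y′ i → i ≢ suc c → setAdjacent v c x y i ≡ setAdjacent v c x y′ i
    setAdjacent-≢suc x y y′ i i≢b with i ≟ᶠ inject₁ c
    ... | yes ≡.refl = ≡.trans (setAdjacent-inject₁ x y) (≡.sym (setAdjacent-inject₁ x y′))
    ... | no  i≢a    =
      ≡.trans (setAdjacent-other x y i i≢a i≢b) (≡.sym (setAdjacent-other x y′ i i≢a i≢b))

  module _ {n} (v : Family (suc n) (suc n)) (c : Fin n) where

    private
      D : (x y : Fin (suc n) → Carrier) → Carrier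
      D x y = det (setAdjacent v c x y)

      D-diagonal : ∀ z → D z z ≈ 0#
      D-diagonal z = det-adjacent-equal (setAdjacent v c z z) c
        (≡⇒≋ (≡.trans (setAdjacent-inject₁ v c z z) (≡.sym (setAdjacent-suc v c z z))))

      D-additiveˡ : ∀ x x′ y → D (zipWith _+_ x x′) y ≈ D x y + D x′ y
      D-additiveˡ x x′ y =
        det-additive (setAdjacent v c (zipWith _+_ x x′) y) (setAdjacent v c x y) (setAdjacent v c x′ y)
          (inject₁ c)
          (≡⇒≋ (≡.trans (setAdjacent-inject₁ v c _ y)
            (≡.sym (≡.cong₂ (zipWith _+_) (setAdjacent-inject₁ v c x y) (setAdjacent-inject₁ v c x′ y)))))
        (λ i i≢a → ≡⇒≋ (setAdjacent-≢inject₁ v c _ x y i i≢a))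
        (λ i i≢a → ≡⇒≋ (setAdjacent-≢inject₁ v c _ x′ y i i≢a))

      D-additiveʳ : ∀ x y y′ → D x (zipWith _+_ y y′) ≈ D x y + D x y′
      D-additiveʳ x y y′ =
        det-additive (setAdjacent v c x (zipWith _+_ y y′)) (setAdjacent v c x y) (setAdjacent v c x y′)
          (suc c)
          (≡⇒≋ (≡.trans (setAdjacent-suc v c x _)
            (≡.sym (≡.cong₂ (zipWith _+_) (setAdjacent-suc v c x y) (setAdjacent-suc v c x y′)))))
        (λ i i≢b → ≡⇒≋ (setAdjacent-≢suc v c x _ y i i≢b))
        (λ i i≢b → ≡⇒≋ (setAdjacent-≢suc v c x _ y′ i i≢b))

    det-setAdjacent-antisym : ∀ x y → D y x ≈ - D x y
    det-setAdjacent-antisym x y = +-inverseʳ-unique (D x y) (D y x) (begin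
      D x y + D y x                                 ≈⟨ +-cong (+-identityˡ _) (+-identityʳ _) ⟨
      (0# + D x y) + (D y x + 0#)                   ≈⟨ +-cong (+-congʳ (D-diagonal x)) (+-congˡ (D-diagonal y)) ⟨
      (D x x + D x y) + (D y x + D y y)             ≈⟨ +-cong (D-additiveʳ x x y) (D-additiveʳ y x y) ⟨
      D x (zipWith _+_ x y) + D y (zipWith _+_ x y) ≈⟨ D-additiveˡ x y _ ⟨
      D (zipWith _+_ x y) (zipWith _+_ x y)         ≈⟨ D-diagonal _ ⟩
      0#                                            ∎)

    det-swap-adjacent : det (setAdjacent v c (v (suc c)) (v (inject₁ c))) ≈ - det v
    det-swap-adjacent = trans (det-setAdjacent-antisym (v (inject₁ c)) (v (suc c)))
                              (-‿cong (det-cong (≡⇒≋ ∘ setAdjacent-self v c)))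

  det-equal-gap : ∀ d {n} (v : Family (suc n) (suc n)) a (c : Fin n) →
                  toℕ a ℕ.+ d ≡ toℕ c → v a ≋ v (suc c) → det v ≈ 0#
  det-equal-gap zero    v a c       a+0≡c va≋vc+1 =
    det-adjacent-equal v c (≡.subst (λ i → v i ≋ v (suc c)) a≡c va≋vc+1)
    where
    a≡c : a ≡ inject₁ c
    a≡c = toℕ-injective (≡.trans (≡.sym (ℕ.+-identityʳ _)) (≡.trans a+0≡c (≡.sym (toℕ-inject₁ c))))
  det-equal-gap (suc d) v a zero    a+d+1≡0   _       = contradiction a+d+1≡0 (ℕ.m+1+n≢0 (toℕ a))
  det-equal-gap (suc d) v a (suc c) a+d+1≡c+1 va≋vc+2 =
    -x≈0⇒x≈0 (trans (sym (det-swap-adjacent v (suc c)))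
                     (det-equal-gap d w a (inject₁ c) a+d≡c′ wa≋wc+1))
    where
    w = setAdjacent v (suc c) (v (suc (suc c))) (v (inject₁ (suc c)))
    a+d≡c : toℕ a ℕ.+ d ≡ toℕ c
    a+d≡c = ℕ.suc-injective (≡.trans (≡.sym (ℕ.+-suc (toℕ a) d)) a+d+1≡c+1)
    a+d≡c′ : toℕ a ℕ.+ d ≡ toℕ (inject₁ c)
    a+d≡c′ = ≡.trans a+d≡c (≡.sym (toℕ-inject₁ c))
    a≤c : toℕ a ℕ.≤ toℕ c
    a≤c = ≡.subst (toℕ a ℕ.≤_) a+d≡c (ℕ.m≤m+n (toℕ a) d)
    wa≡va : w a ≡ v a
    wa≡va = setAdjacent-other v (suc c) _ _ a
      (<⇒≢ (ℕ.s≤s (≡.subst (toℕ a ℕ.≤_) (≡.sym (toℕ-inject₁ c)) a≤c)))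
      (<⇒≢ (ℕ.s≤s (ℕ.m≤n⇒m≤1+n a≤c)))
    wa≋wc+1 : w a ≋ w (suc (inject₁ c))
    wa≋wc+1 = ≡.subst₂ _≋_ (≡.sym wa≡va) (≡.sym (setAdjacent-inject₁ v (suc c) _ _)) va≋vc+2

  det-equal-ordered : ∀ {n} (v : Family n n) {a b} → a Fin.< b → v a ≋ v b → det v ≈ 0#
  det-equal-ordered v {a} {suc c} a<b =
    det-equal-gap (toℕ c ℕ.∸ toℕ a) v a c (ℕ.m+[n∸m]≡n (ℕ.s≤s⁻¹ a<b))

  det-equal : ∀ {n} (v : Family n n) {i j} → i ≢ j → v i ≋ v j → det v ≈ 0#
  det-equal v {i} {j} i≢j vi≋vj with <-cmp i j
  ... | tri< i<j _   _   = det-equal-ordered v i<j vi≋vj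
  ... | tri≈ _   i≡j _   = contradiction i≡j i≢j
  ... | tri> _   _   j<i = det-equal-ordered v j<i (sym ∘ vi≋vj)

  det-addMultiple : ∀ {n} (u w : Family n n) {j k} t → j ≢ k →
                    w j ≋ (λ r → u j r + t * u k r) → (∀ i → i ≢ j → w i ≋ u i) → det w ≈ det u
  det-addMultiple u w {j} {k} t j≢k wj≋uj+tuk w≋u = begin
    det w                ≈⟨ det-linear w u u′ j t wj≋uj+tu′j w≋u w≋u′ ⟩
    det u + t * det u′   ≈⟨ +-congˡ (trans (*-congˡ (det-equal u′ j≢k u′j≋u′k)) (zeroʳ t)) ⟩
    det u + 0#           ≈⟨ +-identityʳ _ ⟩
    det u                ∎
    where
    u′ = updateAt u j (const (u k))
    u′j≡uk : u′ j ≡ u k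
    u′j≡uk = updateAt-updates j u
    wj≋uj+tu′j : w j ≋ (λ r → u j r + t * u′ j r)
    wj≋uj+tu′j r = trans (wj≋uj+tuk r) (reflexive (≡.cong (λ x → u j r + t * x r) (≡.sym u′j≡uk)))
    w≋u′ : ∀ i → i ≢ j → w i ≋ u′ i
    w≋u′ i i≢j = ≡.subst (w i ≋_) (≡.sym (updateAt-minimal i j u i≢j)) (w≋u i i≢j)
    u′j≋u′k : u′ j ≋ u′ k
    u′j≋u′k = ≡⇒≋ (≡.trans u′j≡uk (≡.sym (updateAt-minimal k j u (j≢k ∘ ≡.sym))))

  clear : ∀ {m N} → Family (suc m) N → Fin (suc m) → (Fin m → Carrier) → Family m N
  clear v k t j r = v (punchIn k j) r + t j * v k r

  record Sheared {m N} (v : Family (suc m) N) k (t : Fin m → Carrier) (w : Family (suc m) N) : Set ℓ where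
    constructor _,_
    field
      at-pivot  : w k ≋ v k
      elsewhere : ∀ j → w (punchIn k j) ≋ clear v k t j

  restore : ∀ {m N} → Family (suc m) N → Fin (suc m) → Fin m → Family (suc m) N → Family (suc m) N
  restore v k j w = updateAt w (punchIn k j) (const (v (punchIn k j)))

  Sheared-restore : ∀ {m N} {v w : Family (suc m) N} {k t} j₀ → Sheared v k t w →
                    Sheared v k (updateAt t j₀ (const 0#)) (restore v k j₀ w)
  Sheared-restore {v = v} {w} {k} {t} j₀ (wk≋vk , w≋clear) = w′k≋vk , w′≋clear
    where
    w′ = restore v k j₀ w
    t′ = updateAt t j₀ (const 0#)

    w′k≋vk : w′ k ≋ v k
    w′k≋vk = ≡.subst (_≋ v k) (≡.sym (updateAt-minimal k (punchIn k j₀) w (punchInᵢ≢i k j₀ ∘ ≡.sym)))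
                     wk≋vk

    w′≋clear : ∀ j → w′ (punchIn k j) ≋ clear v k t′ j
    w′≋clear j r with j ≟ᶠ j₀
    ... | yes ≡.refl = begin
      w′ (punchIn k j₀) r                 ≡⟨ ≡.cong-app (updateAt-updates (punchIn k j₀) w) r ⟩
      v (punchIn k j₀) r                  ≈⟨ +-identityʳ _ ⟨
      v (punchIn k j₀) r + 0#             ≈⟨ +-congˡ (zeroˡ _) ⟨
      v (punchIn k j₀) r + 0# * v k r     ≡⟨ ≡.cong (λ x → v (punchIn k j₀) r + x * v k r)
                                                    (updateAt-updates j₀ t) ⟨
      clear v k t′ j₀ r                   ∎
    ... | no  j≢j₀ = begin
      w′ (punchIn k j) r                  ≡⟨ ≡.cong-app (updateAt-minimal _ _ w
                                                    (j≢j₀ ∘ punchIn-injective k j j₀)) r ⟩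
      w (punchIn k j) r                   ≈⟨ w≋clear j r ⟩
      clear v k t j r                     ≡⟨ ≡.cong (λ x → v (punchIn k j) r + x * v k r)
                                                    (updateAt-minimal j j₀ t j≢j₀) ⟨
      clear v k t′ j r                    ∎

  det-restore : ∀ {m} {v w : Family (suc m) (suc m)} {k t} j₀ → Sheared v k t w →
                det w ≈ det (restore v k j₀ w)
  det-restore {v = v} {w} {k} {t} j₀ sheared@(_ , w≋clear) =
    det-addMultiple w′ w (t j₀) (punchInᵢ≢i k j₀) w≋w′+tw′ w≋w′
    where
    w′ = restore v k j₀ w

    w≋w′+tw′ : w (punchIn k j₀) ≋ λ r → w′ (punchIn k j₀) r + t j₀ * w′ k r
    w≋w′+tw′ r = trans (w≋clear j₀ r)
      (+-cong (reflexive (≡.cong-app (≡.sym (updateAt-updates (punchIn k j₀) w)) r))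
              (*-congˡ (sym (Sheared.at-pivot (Sheared-restore j₀ sheared) r))))

    w≋w′ : ∀ i → i ≢ punchIn k j₀ → w i ≋ w′ i
    w≋w′ i i≢ = ≡⇒≋ (≡.sym (updateAt-minimal i (punchIn k j₀) w i≢))

  det-sheared-supported : ∀ {m} (v : Family (suc m) (suc m)) k p t →
                          (∀ j → p ℕ.≤ toℕ j → t j ≈ 0#) →
                          ∀ w → Sheared v k t w → det w ≈ det v
  det-sheared-supported v k zero t t≈0 w (wk≋vk , w≋clear) =
    det-cong {v = w} {w = v} (punchIn-cases k wk≋vk λ j r →
      trans (w≋clear j r) (trans (+-congˡ (trans (*-congʳ (t≈0 j ℕ.z≤n)) (zeroˡ _))) (+-identityʳ _)))
  det-sheared-supported {m} v k (suc p) t t≈0 w sheared with p ℕ.<? m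
  ... | no  p≮m = det-sheared-supported v k p t
                    (λ j p≤j → contradiction (ℕ.≤-<-trans p≤j (toℕ<n j)) p≮m) w sheared
  ... | yes p<m = trans (det-restore j₀ sheared)
                        (det-sheared-supported v k p t′ t′≈0 (restore v k j₀ w)
                                               (Sheared-restore j₀ sheared))
    where
    j₀ = Fin.fromℕ< p<m
    t′ = updateAt t j₀ (const 0#)

    t′≈0 : ∀ j → p ℕ.≤ toℕ j → t′ j ≈ 0#
    t′≈0 j p≤j with j ≟ᶠ j₀
    ... | yes ≡.refl = reflexive (updateAt-updates j₀ t)
    ... | no  j≢j₀   =
      trans (reflexive (updateAt-minimal j j₀ t j≢j₀)) (t≈0 j (ℕ.≤∧≢⇒< p≤j p≢j))
      where
      p≢j : p ≢ toℕ j
      p≢j p≡j = j≢j₀ (toℕ-injective (≡.trans (≡.sym p≡j) (≡.sym (toℕ-fromℕ< p<m))))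

  det-sheared : ∀ {m} (v : Family (suc m) (suc m)) k t w → Sheared v k t w → det w ≈ det v
  det-sheared {m} v k t = det-sheared-supported v k m t λ j m≤j → contradiction (toℕ<n j) (ℕ.≤⇒≯ m≤j)

  pivotMultiples : ∀ {m N} → Family (suc m) (suc N) → Fin (suc m) → Carrier → Fin m → Carrier
  pivotMultiples v k y j = - (v (punchIn k j) zero * y)

  eliminate : ∀ {m N} → Family (suc m) (suc N) → Fin (suc m) → Carrier → Family m N
  eliminate v k y = tails (clear v k (pivotMultiples v k y))

  clear-pivotMultiples-head : ∀ {m N} (v : Family (suc m) (suc N)) k {y} → v k zero * y ≈ 1# →
                              ∀ j → clear v k (pivotMultiples v k y) j zero ≈ 0#
  clear-pivotMultiples-head v k {y} py j = begin
    a + - (a * y) * p    ≈⟨ +-congˡ (-‿distribˡ-* (a * y) p) ⟨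
    a - a * y * p        ≈⟨ +-congˡ (-‿cong (trans (*-assoc a y p) (*-congˡ (trans (*-comm y p) py)))) ⟩
    a - a * 1#           ≈⟨ +-congˡ (-‿cong (*-identityʳ a)) ⟩
    a - a                ≈⟨ -‿inverseʳ a ⟩
    0#                   ∎
    where
    a = v (punchIn k j) zero
    p = v k zero

  det-pivot : ∀ {m} (v : Family (suc m) (suc m)) k {y} → v k zero * y ≈ 1# →
              det v ≈ sign (toℕ k) * (v k zero * det (eliminate v k y))
  det-pivot v k {y} py = begin
    det v                                              ≈⟨ det-sheared v k t u (u-pivot , u-others) ⟨
    det u                                              ≈⟨ sum-single term k others-vanish ⟩
    sign (toℕ k) * (u k zero * det (minor u k))        ≈⟨ *-congˡ {sign (toℕ k)} (*-cong (u-pivot zero)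
                                                            (det-cong λ i r → u-others i (suc r))) ⟩
    sign (toℕ k) * (v k zero * det (eliminate v k y))  ∎
    where
    t = pivotMultiples v k y
    u = insertAt (clear v k t) k (v k)
    u-pivot : u k ≋ v k
    u-pivot = ≡⇒≋ (insertAt-lookup (clear v k t) k (v k))
    u-others : ∀ j → u (punchIn k j) ≋ clear v k t j
    u-others j = ≡⇒≋ (insertAt-punchIn (clear v k t) k (v k) j)
    term : Fin _ → Carrier
    term i = sign (toℕ i) * (u i zero * det (minor u i))
    others-vanish : ∀ j → term (punchIn k j) ≈ 0#
    others-vanish j = trans (*-congˡ {sign (toℕ (punchIn k j))}
      (trans (*-congʳ (trans (u-others j zero) (clear-pivotMultiples-head v k py j))) (zeroˡ _))) (zeroʳ _)

module LinearIndependence {c ℓ} (F : Field c ℓ) where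
  open Field F hiding (zero)
  open import Algebra.Properties.Semiring.Sum semiring using (*-distribʳ-sum)
  open import Algebra.Solver.Ring.NaturalCoefficients.Default commutativeSemiring using (solve; _:=_; _:+_; _:*_)
  open import Relation.Binary.Reasoning.Setoid setoid
  open MonoidSums +-commutativeMonoid
  open Determinants F

  -- The double negation lets elimination split on whether some vector has a nonzero head, which is
  -- not decidable in F.
  LinIndep¬¬ : ∀ {m N} → Family m N → Set (c ⊔ ℓ)
  LinIndep¬¬ {m} {N} v =
    ∀ (λs : Fin m → Carrier) → (∀ r → sum (λ i → λs i * v i r) ≈ 0#) → ∀ i → ¬ ¬ λs i ≈ 0#

  Σᶠ≡sum : ∀ {n} (f : Fin n → Carrier) → Σᶠ F f ≡ sum f
  Σᶠ≡sum {zero}  f = ≡.refl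
  Σᶠ≡sum {suc n} f = ≡.cong (f zero +_) (Σᶠ≡sum (f ∘ suc))

  LinIndep⇒LinIndep¬¬ : ∀ {m N} (v : Family m N) → LinIndep F v → LinIndep¬¬ v
  LinIndep⇒LinIndep¬¬ v indep λs relation i λsi≉0 =
    λsi≉0 (indep λs (λ r → trans (reflexive (Σᶠ≡sum λ i → λs i * v i r)) (relation r)) i)

  δ : ∀ {n} → Fin n → Fin n → Carrier
  δ a b = if does (a ≟ᶠ b) then 1# else 0#

  δ-diag*x≈x : ∀ {n} (a : Fin n) x → δ a a * x ≈ x
  δ-diag*x≈x a x rewrite dec-true (a ≟ᶠ a) ≡.refl = *-identityˡ x

  δ-off*x≈0 : ∀ {n} {a b : Fin n} → a ≢ b → ∀ x → δ a b * x ≈ 0#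
  δ-off*x≈0 {a = a} {b} a≢b x rewrite dec-false (a ≟ᶠ b) a≢b = zeroˡ x

  sum-δ : ∀ {n} a (f : Fin n → Carrier) → sum (λ x → δ a x * f x) ≈ f a
  sum-δ {suc n} a f =
    trans (sum-single (λ x → δ a x * f x) a λ l → δ-off*x≈0 (punchInᵢ≢i a l ∘ ≡.sym) _)
          (δ-diag*x≈x a (f a))

  LinIndep¬¬-reindex : ∀ {m n N} (v : Family n N) (π : Fin m → Fin n) → Injective _≡_ _≡_ π →
                       LinIndep¬¬ v → LinIndep¬¬ (v ∘ π)
  LinIndep¬¬-reindex {suc m} v π π-inj indep μ relation i μi≉0 =
    indep λs relation′ (π i) (λ λsπi≈0 → μi≉0 (trans (sym λs∘π≈μ) λsπi≈0))
    where
    λs : _ → Carrier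
    λs x = sum λ j → δ (π j) x * μ j

    relation′ : ∀ r → sum (λ x → λs x * v x r) ≈ 0#
    relation′ r = begin
      sum (λ x → λs x * v x r)
        ≈⟨ sum-cong-≋ (λ x → *-distribʳ-sum (v x r) λ j → δ (π j) x * μ j) ⟩
      sum (λ x → sum λ j → δ (π j) x * μ j * v x r)
        ≈⟨ ∑-comm (λ x j → δ (π j) x * μ j * v x r) ⟩
      sum (λ j → sum λ x → δ (π j) x * μ j * v x r)
        ≈⟨ sum-cong-≋ (λ j → trans (sum-cong-≋ λ x → *-assoc (δ (π j) x) (μ j) (v x r))
                                   (sum-δ (π j) λ x → μ j * v x r)) ⟩
      sum (λ j → μ j * v (π j) r)
        ≈⟨ relation r ⟩
      0#
        ∎

    λs∘π≈μ : λs (π i) ≈ μ i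
    λs∘π≈μ = trans
      (sum-single (λ j → δ (π j) (π i) * μ j) i λ l → δ-off*x≈0 (punchInᵢ≢i i l ∘ π-inj) _)
      (δ-diag*x≈x (π i) (μ i))

  LinIndep¬¬-tails : ∀ {m N} (v : Family m (suc N)) → ¬ ¬ (∀ i → v i zero ≈ 0#) →
                     LinIndep¬¬ v → LinIndep¬¬ (tails v)
  LinIndep¬¬-tails v heads≈0 indep μ relation i μi≉0 =
    heads≈0 λ v₀≈0 → indep μ (relation′ v₀≈0) i μi≉0
    where
    relation′ : (∀ i → v i zero ≈ 0#) → ∀ r → sum (λ i → μ i * v i r) ≈ 0#
    relation′ v₀≈0 zero    = sum-zero _ λ i → trans (*-congˡ (v₀≈0 i)) (zeroʳ (μ i))
    relation′ v₀≈0 (suc r) = relation r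

  LinIndep¬¬-clear : ∀ {m N} (v : Family (suc m) N) k t → LinIndep¬¬ v → LinIndep¬¬ (clear v k t)
  LinIndep¬¬-clear v k t indep μ relation i =
    ≡.subst (λ x → ¬ ¬ x ≈ 0#) (insertAt-punchIn μ k λk i) (indep λs relation′ (punchIn k i))
    where
    λk = sum λ j → μ j * t j
    λs = insertAt μ k λk

    relation′ : ∀ r → sum (λ x → λs x * v x r) ≈ 0#
    relation′ r = begin
      sum (λ x → λs x * v x r)
        ≈⟨ sum-remove (λ x → λs x * v x r) ⟩
      λs k * v k r + sum (λ j → λs (punchIn k j) * v (punchIn k j) r)
        ≡⟨ ≡.cong₂ (λ x y → x * v k r + y) (insertAt-lookup μ k λk)
                   (sum-cong-≗ λ j → ≡.cong (_* v (punchIn k j) r) (insertAt-punchIn μ k λk j)) ⟩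
      λk * v k r + sum (λ j → μ j * v (punchIn k j) r)
        ≈⟨ +-congʳ (*-distribʳ-sum (v k r) λ j → μ j * t j) ⟩
      sum (λ j → μ j * t j * v k r) + sum (λ j → μ j * v (punchIn k j) r)
        ≈⟨ ∑-distrib-+ (λ j → μ j * t j * v k r) (λ j → μ j * v (punchIn k j) r) ⟨
      sum (λ j → μ j * t j * v k r + μ j * v (punchIn k j) r)
        ≈⟨ sum-cong-≋ (λ j → regroup (μ j) (t j) (v k r) _) ⟩
      sum (λ j → μ j * clear v k t j r)
        ≈⟨ relation r ⟩
      0#
        ∎
      where
      regroup : ∀ μ t p a → μ * t * p + μ * a ≈ μ * (a + t * p)
      regroup = solve 4 (λ μ t p a → μ :* t :* p :+ μ :* a := μ :* (a :+ t :* p)) refl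

  LinIndep¬¬-eliminate : ∀ {m N} (v : Family (suc m) (suc N)) k {y} → v k zero * y ≈ 1# →
                         LinIndep¬¬ v → LinIndep¬¬ (eliminate v k y)
  LinIndep¬¬-eliminate v k py indep =
    LinIndep¬¬-tails _ (λ ¬heads≈0 → ¬heads≈0 (clear-pivotMultiples-head v k py))
                       (LinIndep¬¬-clear v k _ indep)

  elimination-cases : ∀ {m N} (v : Family (suc m) (suc N)) → LinIndep¬¬ v →
                      (∀ k y → v k zero * y ≈ 1# → LinIndep¬¬ (eliminate v k y) → ⊥) →
                      (LinIndep¬¬ (tails v) → ⊥) → ⊥
  elimination-cases v indep pivot-case zero-case =
    zero-case (LinIndep¬¬-tails v (¬¬-∀-Fin no-pivot) indep)
    where
    no-pivot : ∀ k → ¬ ¬ v k zero ≈ 0#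
    no-pivot k vk≉0 with y , py ← inverse (v k zero) vk≉0 =
      pivot-case k y py (LinIndep¬¬-eliminate v k py indep)

  ¬LinIndep¬¬-overfull : ∀ {m N} → N ℕ.< m → (v : Family m N) → ¬ LinIndep¬¬ v
  ¬LinIndep¬¬-overfull {suc m} {zero}  _          v indep = indep (λ _ → 1#) (λ ()) zero 1≉0
  ¬LinIndep¬¬-overfull {suc m} {suc N} (ℕ.s≤s N<m) v indep = elimination-cases v indep
    (λ k y _ → ¬LinIndep¬¬-overfull N<m (eliminate v k y))
    (¬LinIndep¬¬-overfull (ℕ.m<n⇒m<1+n N<m) (tails v))

  LinIndep¬¬⇒det≉0 : ∀ {n} (v : Family n n) → LinIndep¬¬ v → ¬ det v ≈ 0#
  LinIndep¬¬⇒det≉0 {zero}  v _     = 1≉0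
  LinIndep¬¬⇒det≉0 {suc m} v indep det≈0 = elimination-cases v indep
    (λ k y py indep′ → LinIndep¬¬⇒det≉0 (eliminate v k y) indep′
      (x*y≈1⇒x*z≈0⇒z≈0 py (sign*x≈0⇒x≈0 (toℕ k) (trans (sym (det-pivot v k py)) det≈0))))
    (¬LinIndep¬¬-overfull (ℕ.n<1+n m) (tails v))

module Polynomials {c ℓ} (F : Field c ℓ) where
  open Field F hiding (zero)
  open Determinants F
  open MonoidSums +-commutativeMonoid using (sum; sum-cong-≋)
  module ∏ = MonoidSums *-commutativeMonoid
  module ∑ℕ = MonoidSums ℕ.+-0-commutativeMonoid
  open import Algebra.Properties.Semiring.Exp semiring using (_^_; ^-homo-*)
  open import Algebra.Solver.Ring.NaturalCoefficients.Default commutativeSemiring using (solve; _:=_; _:+_; _:*_)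
  open import Relation.Binary.Reasoning.Setoid setoid

  _⊕_ : ∀ {R m} → Exponent F R m → Exponent F R m → Exponent F R m
  (e ⊕ e′) r c = e r c ℕ.+ e′ r c

  0ᵉ : ∀ {R m} → Exponent F R m
  0ᵉ r c = 0

  var : ∀ {R m} → Fin R → Fin m → Exponent F R m
  var r c r′ c′ = if does (≡-dec _≟ᶠ_ _≟ᶠ_ (r , c) (r′ , c′)) then 1 else 0

  var-self : ∀ {R m} (r : Fin R) (c : Fin m) → var r c r c ≡ 1
  var-self r c rewrite dec-true (≡-dec _≟ᶠ_ _≟ᶠ_ (r , c) (r , c)) ≡.refl = ≡.refl

  var-off : ∀ {R m} (r r′ : Fin R) (c c′ : Fin m) → (r , c) ≢ (r′ , c′) → var r c r′ c′ ≡ 0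
  var-off r r′ c c′ ≢ rewrite dec-false (≡-dec _≟ᶠ_ _≟ᶠ_ (r , c) (r′ , c′)) ≢ = ≡.refl

  var-off-row : ∀ {R m} {r r′ : Fin R} → r ≢ r′ → (c c′ : Fin m) → var r c r′ c′ ≡ 0
  var-off-row {r = r} {r′} r≢r′ c c′ = var-off r r′ c c′ (r≢r′ ∘ proj₁ ∘ ×-≡,≡←≡)

  var-off-column : ∀ {R m} {c c′ : Fin m} → c ≢ c′ → (r r′ : Fin R) → var r c r′ c′ ≡ 0
  var-off-column {c = c} {c′} c≢c′ r r′ = var-off r r′ c c′ (c≢c′ ∘ proj₂ ∘ ×-≡,≡←≡)

  var⊕-self≢0 : ∀ {R m} (r : Fin R) (c : Fin m) (e : Exponent F R m) → (var r c ⊕ e) r c ≢ 0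
  var⊕-self≢0 r c e 1+e≡0 = ℕ.1+n≢0 (≡.trans (≡.cong (ℕ._+ e r c) (≡.sym (var-self r c))) 1+e≡0)

  sumℕ≡sum : ∀ {n} (f : Fin n → ℕ) → sumℕ f ≡ ∑ℕ.sum f
  sumℕ≡sum {zero}  f = ≡.refl
  sumℕ≡sum {suc n} f = ≡.cong (f zero ℕ.+_) (sumℕ≡sum (f ∘ suc))

  monDeg≡∑∑ : ∀ {R m} (e : Exponent F R m) → monDeg F e ≡ ∑ℕ.sum (λ r → ∑ℕ.sum (e r))
  monDeg≡∑∑ e = ≡.trans (sumℕ≡sum λ r → sumℕ (e r)) (∑ℕ.sum-cong-≗ λ r → sumℕ≡sum (e r))

  monDeg-⊕ : ∀ {R m} (e e′ : Exponent F R m) → monDeg F (e ⊕ e′) ≡ monDeg F e ℕ.+ monDeg F e′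
  monDeg-⊕ {R} {m} e e′ = ≡.trans (monDeg≡∑∑ (e ⊕ e′))
    (≡.trans (∑ℕ.∑∑-distrib {R} {m} e e′)
             (≡.sym (≡.cong₂ ℕ._+_ (monDeg≡∑∑ e) (monDeg≡∑∑ e′))))

  monDeg-var : ∀ {R m} (r : Fin R) (c : Fin m) → monDeg F (var r c) ≡ 1
  monDeg-var {suc R} {suc m} r c = ≡.trans (monDeg≡∑∑ (var r c)) (≡.trans
    (∑ℕ.∑∑-single (var r c) r c (λ r′ c′ → var-off-row (punchInᵢ≢i r r′ ∘ ≡.sym) c c′)
                                 (λ c′ → var-off-column (punchInᵢ≢i c c′ ∘ ≡.sym) r r))
    (var-self r c))

  monDeg-0ᵉ : ∀ {R m} → monDeg F (0ᵉ {R} {m}) ≡ 0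
  monDeg-0ᵉ {R} {m} = ≡.trans (monDeg≡∑∑ (0ᵉ {R} {m}))
    (∑ℕ.sum-zero {R} (λ r → ∑ℕ.sum {m} λ c → 0) λ r →
      ∑ℕ.sum-zero {m} (λ c → 0) λ c → ≡.refl)

  Πᶠ≡product : ∀ {n} (f : Fin n → Carrier) → Πᶠ F f ≡ ∏.sum f
  Πᶠ≡product {zero}  f = ≡.refl
  Πᶠ≡product {suc n} f = ≡.cong (f zero *_) (Πᶠ≡product (f ∘ suc))

  pow≡^ : ∀ x k → pow F x k ≡ x ^ k
  pow≡^ x zero    = ≡.refl
  pow≡^ x (suc k) = ≡.cong (x *_) (pow≡^ x k)

  evalMon≡∏∏ : ∀ {R m} (e : Exponent F R m) M →
               evalMon F e M ≡ ∏.sum (λ r → ∏.sum λ c → M r c ^ e r c)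
  evalMon≡∏∏ e M =
    ≡.trans (Πᶠ≡product λ r → Πᶠ F λ c → pow F (M r c) (e r c)) (∏.sum-cong-≗ λ r →
      ≡.trans (Πᶠ≡product λ c → pow F (M r c) (e r c)) (∏.sum-cong-≗ λ c → pow≡^ (M r c) (e r c)))

  evalMon-⊕ : ∀ {R m} (e e′ : Exponent F R m) M →
              evalMon F (e ⊕ e′) M ≈ evalMon F e M * evalMon F e′ M
  evalMon-⊕ {R} {m} e e′ M = begin
    evalMon F (e ⊕ e′) M
      ≡⟨ evalMon≡∏∏ (e ⊕ e′) M ⟩
    ∏.sum (λ r → ∏.sum λ c → M r c ^ (e r c ℕ.+ e′ r c))
      ≈⟨ ∏.sum-cong-≋ (λ r → ∏.sum-cong-≋ λ c → ^-homo-* (M r c) (e r c) (e′ r c)) ⟩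
    ∏.sum (λ r → ∏.sum λ c → M r c ^ e r c * M r c ^ e′ r c)
      ≈⟨ ∏.∑∑-distrib {R} {m} (λ r c → M r c ^ e r c) (λ r c → M r c ^ e′ r c) ⟩
    ∏.sum (λ r → ∏.sum λ c → M r c ^ e r c) * ∏.sum (λ r → ∏.sum λ c → M r c ^ e′ r c)
      ≡⟨ ≡.cong₂ _*_ (evalMon≡∏∏ e M) (evalMon≡∏∏ e′ M) ⟨
    evalMon F e M * evalMon F e′ M
      ∎

  evalMon-var : ∀ {R m} (r : Fin R) (c : Fin m) M → evalMon F (var r c) M ≈ M r c
  evalMon-var {suc R} {suc m} r c M = begin
    evalMon F (var r c) M                            ≡⟨ evalMon≡∏∏ (var r c) M ⟩
    ∏.sum (λ r′ → ∏.sum λ c′ → M r′ c′ ^ var r c r′ c′)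
      ≈⟨ ∏.∑∑-single (λ r′ c′ → M r′ c′ ^ var r c r′ c′) r c
           (λ r′ c′ → reflexive (≡.cong (M _ c′ ^_)
                                          (var-off-row (punchInᵢ≢i r r′ ∘ ≡.sym) c c′)))
           (λ c′ → reflexive (≡.cong (M r _ ^_) (var-off-column (punchInᵢ≢i c c′ ∘ ≡.sym) r r))) ⟩
    M r c ^ var r c r c                              ≡⟨ ≡.cong (M r c ^_) (var-self r c) ⟩
    M r c * 1#                                       ≈⟨ *-identityʳ (M r c) ⟩
    M r c                                            ∎

  evalMon-0ᵉ : ∀ {R m} M → evalMon F (0ᵉ {R} {m}) M ≈ 1#
  evalMon-0ᵉ {R} {m} M = trans (reflexive (evalMon≡∏∏ 0ᵉ M))
    (∏.sum-zero {R} (λ r → ∏.sum {m} λ c → 1#) λ r → ∏.sum-zero {m} (λ c → 1#) λ c → refl)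

  scale : ∀ {R m} → Carrier → Term F R m → Term F R m
  scale a t = a * proj₁ t , proj₂ t

  mulVar : ∀ {R m} → Fin R → Fin m → Term F R m → Term F R m
  mulVar r c t = proj₁ t , var r c ⊕ proj₂ t

  alternating : ∀ {k R m} → (Fin k → List (Term F R m)) → List (Term F R m)
  alternating blocks = concat (tabulate λ j → map (scale (sign (toℕ j))) (blocks j))

  detTerms : ∀ {R m} k → (Fin k → Fin R) → (Fin k → Fin m) → List (Term F R m)
  detTerms zero    ρ κ = (1# , 0ᵉ) ∷ []
  detTerms (suc k) ρ κ =
    alternating λ j → map (mulVar (ρ zero) (κ j)) (detTerms k (ρ ∘ suc) (κ ∘ punchIn j))

  module _ {R m} (M : Fin R → Fin m → Carrier) where

    ⟦_⟧ : List (Term F R m) → Carrier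
    ⟦ ts ⟧ = evalTerms F ts M

    ⟦⟧-++ : ∀ xs ys → ⟦ xs ++ ys ⟧ ≈ ⟦ xs ⟧ + ⟦ ys ⟧
    ⟦⟧-++ []       ys = sym (+-identityˡ _)
    ⟦⟧-++ (t ∷ xs) ys = trans (+-congˡ (⟦⟧-++ xs ys)) (sym (+-assoc _ _ _))

    ⟦⟧-concat-tabulate : ∀ {k} (blocks : Fin k → List (Term F R m)) →
                         ⟦ concat (tabulate blocks) ⟧ ≈ sum (λ j → ⟦ blocks j ⟧)
    ⟦⟧-concat-tabulate {zero}  blocks = refl
    ⟦⟧-concat-tabulate {suc k} blocks =
      trans (⟦⟧-++ (blocks zero) _) (+-congˡ (⟦⟧-concat-tabulate (blocks ∘ suc)))

    ⟦⟧-scale : ∀ a ts → ⟦ map (scale a) ts ⟧ ≈ a * ⟦ ts ⟧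
    ⟦⟧-scale a []       = sym (zeroʳ a)
    ⟦⟧-scale a (t ∷ ts) = trans (+-cong (*-assoc _ _ _) (⟦⟧-scale a ts)) (sym (distribˡ a _ _))

    ⟦⟧-mulVar : ∀ r c ts → ⟦ map (mulVar r c) ts ⟧ ≈ M r c * ⟦ ts ⟧
    ⟦⟧-mulVar r c []       = sym (zeroʳ _)
    ⟦⟧-mulVar r c (t ∷ ts) = begin
      b * evalMon F (var r c ⊕ e) M + ⟦ map (mulVar r c) ts ⟧
        ≈⟨ +-cong (*-congˡ (trans (evalMon-⊕ (var r c) e M) (*-congʳ (evalMon-var r c M))))
                  (⟦⟧-mulVar r c ts) ⟩
      b * (M r c * evalMon F e M) + M r c * ⟦ ts ⟧
        ≈⟨ +-congʳ (solve 3 (λ b x y → b :* (x :* y) := x :* (b :* y)) refl b (M r c) (evalMon F e M)) ⟩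
      M r c * (b * evalMon F e M) + M r c * ⟦ ts ⟧
        ≈⟨ distribˡ (M r c) _ _ ⟨
      M r c * ⟦ t ∷ ts ⟧
        ∎
      where
      b = proj₁ t
      e = proj₂ t

    ⟦⟧-alternating : ∀ {k} (blocks : Fin k → List (Term F R m)) →
                     ⟦ alternating blocks ⟧ ≈ sum (λ j → sign (toℕ j) * ⟦ blocks j ⟧)
    ⟦⟧-alternating blocks = trans (⟦⟧-concat-tabulate λ j → map (scale (sign (toℕ j))) (blocks j))
                                  (sum-cong-≋ λ j → ⟦⟧-scale (sign (toℕ j)) (blocks j))

    ⟦⟧-detTerms : ∀ k ρ κ → ⟦ detTerms k ρ κ ⟧ ≈ det (λ j r → M (ρ r) (κ j))
    ⟦⟧-detTerms zero    ρ κ = trans (+-identityʳ _) (trans (*-identityˡ _) (evalMon-0ᵉ M))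
    ⟦⟧-detTerms (suc k) ρ κ =
      trans (⟦⟧-alternating (λ j → map (mulVar (ρ zero) (κ j)) (minorTerms j))) (sum-cong-≋ λ j →
      *-congˡ {sign (toℕ j)} (trans (⟦⟧-mulVar (ρ zero) (κ j) (minorTerms j))
                                    (*-congˡ (⟦⟧-detTerms k (ρ ∘ suc) (κ ∘ punchIn j)))))
      where
      minorTerms : Fin (suc k) → List (Term F R m)
      minorTerms j = detTerms k (ρ ∘ suc) (κ ∘ punchIn j)

  All-alternating : ∀ {p k R m} {P : Term F R m → Set p} {blocks : Fin k → List (Term F R m)} →
                    (∀ j {t} → P t → P (scale (sign (toℕ j)) t)) → (∀ j → All P (blocks j)) →
                    All P (alternating blocks)
  All-alternating P-scale all-P = All.concat⁺ (All.tabulate⁺ λ j → All.map⁺ (All.map (P-scale j) (all-P j)))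

  Any-alternating : ∀ {p k R m} {P : Term F R m → Set p} {blocks : Fin (suc k) → List (Term F R m)} →
                    (∀ {t} → P t → P (scale 1# t)) →
                    Any.Any P (blocks zero) → Any.Any P (alternating blocks)
  Any-alternating P-scale any-P = Any.++⁺ˡ (Any.map⁺ (Any.map P-scale any-P))

  Distinct : ∀ {R m} → Term F R m → Term F R m → Set
  Distinct t t′ = ¬ SameExponent F (proj₂ t) (proj₂ t′)

  AllPairs-alternating : ∀ {q k R m} (Q : Fin k → Exponent F R m → Set q)
                         {blocks : Fin k → List (Term F R m)} →
                         (∀ j → AllPairs Distinct (blocks j)) → (∀ j → All (Q j ∘ proj₂) (blocks j)) →
                         (∀ {i j e e′} → i ≢ j → Q i e → Q j e′ → ¬ SameExponent F e e′) →
                         AllPairs Distinct (alternating blocks)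
  AllPairs-alternating Q distinct labelled separated = AllPairs-concat-tabulate (λ j → Q j ∘ proj₂)
    (λ j → AllPairs.map⁺ (distinct j)) (λ j → All.map⁺ (labelled j)) separated

  record IsDetTerm {R m} k (ρ : Fin k → Fin R) (κ : Fin k → Fin m) (t : Term F R m) : Set ℓ where
    field
      coefficient≉0  : ¬ proj₁ t ≈ 0#
      degree         : monDeg F (proj₂ t) ≡ k
      rowsOutside    : ∀ r c → (∀ i → ρ i ≢ r) → proj₂ t r c ≡ 0
      columnsOutside : ∀ r c → (∀ i → κ i ≢ c) → proj₂ t r c ≡ 0
      columnsUsed    : ∀ i → ∃ λ r → proj₂ t r (κ i) ≢ 0

  IsDetTerm-scale : ∀ {R m k ρ κ} n {t : Term F R m} →
                    IsDetTerm k ρ κ t → IsDetTerm k ρ κ (scale (sign n) t)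
  IsDetTerm-scale n d = record
    { coefficient≉0  = coefficient≉0 ∘ sign*x≈0⇒x≈0 n
    ; degree         = degree
    ; rowsOutside    = rowsOutside
    ; columnsOutside = columnsOutside
    ; columnsUsed    = columnsUsed
    }
    where open IsDetTerm d

  IsDetTerm-mulVar : ∀ {R m k} (ρ : Fin (suc k) → Fin R) (κ : Fin (suc k) → Fin m) j {t} →
                     IsDetTerm k (ρ ∘ suc) (κ ∘ punchIn j) t →
                     IsDetTerm (suc k) ρ κ (mulVar (ρ zero) (κ j) t)
  IsDetTerm-mulVar {R} {m} ρ κ j {t} d = record
    { coefficient≉0  = coefficient≉0
    ; degree         = ≡.trans (monDeg-⊕ (var (ρ zero) (κ j)) e)
                               (≡.cong₂ ℕ._+_ (monDeg-var (ρ zero) (κ j)) degree)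
    ; rowsOutside    = λ r c r∉ρ → ≡.cong₂ ℕ._+_ (var-off-row (r∉ρ zero) (κ j) c)
                                                 (rowsOutside r c (r∉ρ ∘ suc))
    ; columnsOutside = λ r c c∉κ → ≡.cong₂ ℕ._+_ (var-off-column (c∉κ j) (ρ zero) r)
                                                 (columnsOutside r c (c∉κ ∘ punchIn j))
    ; columnsUsed    = used
    }
    where
    open IsDetTerm d
    e = proj₂ t
    used : ∀ i → ∃ λ r → var (ρ zero) (κ j) r (κ i) ℕ.+ e r (κ i) ≢ 0
    used i with i ≟ᶠ j
    ... | yes ≡.refl = ρ zero , var⊕-self≢0 (ρ zero) (κ i) e
    ... | no  i≢j    with r , e≢0 ← columnsUsed (punchOut (i≢j ∘ ≡.sym)) =
      r , λ sum≡0 → e≢0 (≡.subst (λ x → e r (κ x) ≡ 0) (≡.sym (punchIn-punchOut (i≢j ∘ ≡.sym)))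
                                 (ℕ.m+n≡0⇒n≡0 _ sum≡0))

  IsDetTerm-unit : ∀ {R m} {ρ : Fin 0 → Fin R} {κ : Fin 0 → Fin m} → IsDetTerm 0 ρ κ (1# , 0ᵉ)
  IsDetTerm-unit {R} {m} = record
    { coefficient≉0  = 1≉0
    ; degree         = monDeg-0ᵉ {R} {m}
    ; rowsOutside    = λ _ _ _ → ≡.refl
    ; columnsOutside = λ _ _ _ → ≡.refl
    ; columnsUsed    = λ ()
    }

  detTerms-IsDetTerm : ∀ {R m} k (ρ : Fin k → Fin R) (κ : Fin k → Fin m) →
                       All (IsDetTerm k ρ κ) (detTerms k ρ κ)
  detTerms-IsDetTerm zero    ρ κ = IsDetTerm-unit All.∷ All.[]
  detTerms-IsDetTerm (suc k) ρ κ = All-alternating (IsDetTerm-scale ∘ toℕ) λ j →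
    All.map⁺ (All.map (IsDetTerm-mulVar ρ κ j) (detTerms-IsDetTerm k (ρ ∘ suc) (κ ∘ punchIn j)))

  detTerms-nonempty : ∀ {R m} k (ρ : Fin k → Fin R) (κ : Fin k → Fin m) →
                      Any.Any (IsDetTerm k ρ κ) (detTerms k ρ κ)
  detTerms-nonempty zero    ρ κ = Any.here IsDetTerm-unit
  detTerms-nonempty (suc k) ρ κ =
    Any-alternating {blocks = λ j → map (mulVar (ρ zero) (κ j)) (detTerms k (ρ ∘ suc) (κ ∘ punchIn j))}
      (IsDetTerm-scale 0)
      (Any.map⁺ (Any.map (IsDetTerm-mulVar ρ κ zero) (detTerms-nonempty k (ρ ∘ suc) (κ ∘ punchIn zero))))

  detTerms-distinct : ∀ {R m} k (ρ : Fin k → Fin R) (κ : Fin k → Fin m) →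
                      Injective _≡_ _≡_ ρ → Injective _≡_ _≡_ κ → AllPairs Distinct (detTerms k ρ κ)
  detTerms-distinct zero    ρ κ _     _     = All.[] AllPairs.∷ AllPairs.[]
  detTerms-distinct {R} {m} (suc k) ρ κ ρ-inj κ-inj = AllPairs-alternating Q {blocks} distinct-block
    (λ j → All.map⁺ {f = mulVar (ρ zero) (κ j)}
                    (All.map (labelled j) (detTerms-IsDetTerm k (ρ ∘ suc) (κ ∘ punchIn j))))
    separated
    where
    blocks : Fin (suc k) → List (Term F R m)
    blocks j = map (mulVar (ρ zero) (κ j)) (detTerms k (ρ ∘ suc) (κ ∘ punchIn j))

    distinct-mulVar : ∀ {r c t t′} → Distinct t t′ → Distinct (mulVar {R} {m} r c t) (mulVar r c t′)
    distinct-mulVar {r₀} {c₀} d same = d λ r c → ℕ.+-cancelˡ-≡ (var r₀ c₀ r c) _ _ (same r c)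

    distinct-block : ∀ j → AllPairs Distinct (blocks j)
    distinct-block j = AllPairs.map⁺ (AllPairs.map {S = Distinct on mulVar (ρ zero) (κ j)}
      (λ {t} {t′} → distinct-mulVar {ρ zero} {κ j} {t} {t′})
      (detTerms-distinct k (ρ ∘ suc) (κ ∘ punchIn j) (λ eq → suc-injective (ρ-inj eq))
                         (λ {x} {y} eq → punchIn-injective j x y (κ-inj eq))))

    Q : Fin (suc k) → Exponent F R m → Set
    Q j e = e (ρ zero) (κ j) ≢ 0 × (∀ j′ → j′ ≢ j → e (ρ zero) (κ j′) ≡ 0)

    labelled : ∀ j {t} → IsDetTerm k (ρ ∘ suc) (κ ∘ punchIn j) t → Q j (var (ρ zero) (κ j) ⊕ proj₂ t)
    labelled j {t} d = var⊕-self≢0 (ρ zero) (κ j) (proj₂ t) , λ j′ j′≢j →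
      ≡.cong₂ ℕ._+_ (var-off-column (j′≢j ∘ ≡.sym ∘ κ-inj) (ρ zero) (ρ zero)) (top-row (κ j′))
      where
      top-row : ∀ c → proj₂ t (ρ zero) c ≡ 0
      top-row c = IsDetTerm.rowsOutside d (ρ zero) c λ i → ℕ.1+n≢0 ∘ ≡.cong toℕ ∘ ρ-inj

    separated : ∀ {i j e e′} → i ≢ j → Q i e → Q j e′ → ¬ SameExponent F e e′
    separated {i} i≢j (e≢0 , _) (_ , e′≡0) same = e≢0 (≡.trans (same (ρ zero) (κ i)) (e′≡0 i i≢j))

  ρ₀ : ∀ {m} → Fin m → Fin (suc (suc m))
  ρ₀ r = inject₁ (suc r)

  trimmed : ∀ {m} → (Fin (suc (suc m)) → Fin (suc m) → Carrier) → Family (suc m) (suc m)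
  trimmed M j zero    = 1#
  trimmed M j (suc r) = M (ρ₀ r) j

  gTerms : ∀ m → List (Term F (suc (suc m)) (suc m))
  gTerms m = alternating λ j → detTerms m ρ₀ (punchIn j)

  ρ₀-injective : ∀ {m} → Injective _≡_ _≡_ (ρ₀ {m})
  ρ₀-injective eq = suc-injective (inject₁-injective eq)

  gTerms-distinct : ∀ m → AllPairs Distinct (gTerms m)
  gTerms-distinct m = AllPairs-alternating Q
    (λ j → detTerms-distinct m ρ₀ (punchIn j) ρ₀-injective λ {x} {y} → punchIn-injective j x y)
    (λ j → All.map (labelled j) (detTerms-IsDetTerm m ρ₀ (punchIn j)))
    separated
    where
    Q : Fin (suc m) → Exponent F (suc (suc m)) (suc m) → Set
    Q j e = (∀ r → e r j ≡ 0) × (∀ j′ → j′ ≢ j → ∃ λ r → e r j′ ≢ 0)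

    labelled : ∀ j {t} → IsDetTerm m ρ₀ (punchIn j) t → Q j (proj₂ t)
    labelled j {t} d = (λ r → columnsOutside r j (punchInᵢ≢i j)) , used
      where
      open IsDetTerm d
      used : ∀ j′ → j′ ≢ j → ∃ λ r → proj₂ t r j′ ≢ 0
      used j′ j′≢j = ≡.subst (λ c → ∃ λ r → proj₂ t r c ≢ 0) (punchIn-punchOut (j′≢j ∘ ≡.sym))
                             (columnsUsed (punchOut (j′≢j ∘ ≡.sym)))

    separated : ∀ {i j e e′} → i ≢ j → Q i e → Q j e′ → ¬ SameExponent F e e′
    separated {i} i≢j (column-i≡0 , _) (_ , uses) same with r , e′≢0 ← uses i i≢j =
      e′≢0 (≡.trans (≡.sym (same r i)) (column-i≡0 r))

  g : ∀ m → Polynomial F (suc (suc m)) (suc m)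
  g m = record
    { terms       = gTerms m
    ; nonzeroCoef = All-alternating (λ j nz → nz ∘ sign*x≈0⇒x≈0 (toℕ j)) λ j →
                      All.map IsDetTerm.coefficient≉0 (detTerms-IsDetTerm m ρ₀ (punchIn j))
    ; distinctExp = gTerms-distinct m
    }

  g-degree : ∀ m → HasDegree F (g m) m
  g-degree m =
      All.map ℕ.≤-reflexive (All-alternating (λ _ → id) λ j →
        All.map IsDetTerm.degree (detTerms-IsDetTerm m ρ₀ (punchIn j)))
    , Any-alternating {blocks = λ j → detTerms m ρ₀ (punchIn j)} id
        (Any.map IsDetTerm.degree (detTerms-nonempty m ρ₀ (punchIn zero)))

  eval-g : ∀ {m} M → eval F (g m) M ≈ det (trimmed M)
  eval-g {m} M = trans (⟦⟧-alternating M λ j → detTerms m ρ₀ (punchIn j)) (sum-cong-≋ λ j →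
    *-congˡ {sign (toℕ j)} (trans (⟦⟧-detTerms M m ρ₀ (punchIn j)) (sym (*-identityˡ _))))

module Palettes {c ℓ} (F : Field c ℓ) where
  open Field F hiding (zero)
  open Determinants F
  open LinearIndependence F
  open Polynomials F
  open import Data.Vec.Functional.Relation.Binary.Equality.Setoid setoid using (_≋_)

  Collision : ∀ {R m} → (Fin R → Fin m → Carrier) → Set ℓ
  Collision M = ∃₂ λ i j → i ≢ j × _≈ᵛ_ F (column F M i) (column F M j)

  collision⇒g≈0 : ∀ {m} (M : Fin (suc (suc m)) → Fin (suc m) → Carrier) →
                  Collision M → eval F (g m) M ≈ 0#
  collision⇒g≈0 M (i , j , i≢j , Mi≈Mj) = trans (eval-g M) (det-equal (trimmed M) i≢j trimmed-i≋j)
    where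
    trimmed-i≋j : trimmed M i ≋ trimmed M j
    trimmed-i≋j zero    = refl
    trimmed-i≋j (suc r) = Mi≈Mj (ρ₀ r)

  module _ {m} (cs : Fin (suc (suc m)) → Fin (suc (suc m)) → Carrier)
               (M : Fin (suc (suc m)) → Fin (suc m) → Carrier) where

    trimmed-colored : (∀ i → cs i zero ≈ 1#) → ∀ j i →
                      _≈ᵛ_ F (column F M j) (cs i) → trimmed M j ≋ dropLast F (cs i)
    trimmed-colored first≈1 j i Mj≈ci zero    = sym (first≈1 i)
    trimmed-colored first≈1 j i Mj≈ci (suc r) = Mj≈ci (ρ₀ r)

    det-trimmed≉0 : IsPalette F cs → (colour : Fin (suc m) → Fin (suc (suc m))) → Injective _≡_ _≡_ colour →
                    (∀ j → _≈ᵛ_ F (column F M j) (cs (colour j))) → ¬ det (trimmed M) ≈ 0#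
    det-trimmed≉0 (first≈1 , _ , independent) colour colour-inj colored
      with k , π , π-inj , punchIn∘π≡colour ← punchIn-factorisation colour colour-inj =
      LinIndep¬¬⇒det≉0 remaining remaining-independent ∘ trans (det-cong remaining≋trimmed)
      where
      palette-minus-k : Family (suc m) (suc m)
      palette-minus-k i = dropLast F (cs (punchIn k i))
      remaining : Family (suc m) (suc m)
      remaining = palette-minus-k ∘ π
      remaining-independent : LinIndep¬¬ remaining
      remaining-independent =
        LinIndep¬¬-reindex palette-minus-k π π-inj (LinIndep⇒LinIndep¬¬ palette-minus-k (independent k))
      remaining≋trimmed : ∀ j → remaining j ≋ trimmed M j
      remaining≋trimmed j r = sym (≡.subst (λ i → trimmed M j ≋ dropLast F (cs i))
                                           (≡.sym (punchIn∘π≡colour j))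
                                           (trimmed-colored first≈1 j (colour j) (colored j)) r)

    g≈0⇒collision : IsPalette F cs → Colored F cs M → eval F (g m) M ≈ 0# → Collision M
    g≈0⇒collision palette colored g≈0 with collision-or-injective (proj₁ ∘ colored)
    ... | inj₁ (i , j , i≢j , same-colour) = i , j , i≢j , λ r →
      trans (proj₂ (colored i) r)
            (trans (reflexive (≡.cong (λ x → cs x r) same-colour)) (sym (proj₂ (colored j) r)))
    ... | inj₂ injective = ⊥-elim
      (det-trimmed≉0 palette (proj₁ ∘ colored) injective (proj₂ ∘ colored) (trans (sym (eval-g M)) g≈0))

lemma2p6 : ∀ {c ℓ : Level} (F : Field c ℓ) (n : ℕ) → 1 ≤ n →
    (cs : Fin (suc n) → Fin (suc n) → Field.Carrier F) → IsPalette F cs →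
    ∃ λ (g : Polynomial F (suc n) n) →
      HasDegree F g (n Data.Nat.∸ 1) ×
      ((M : Fin (suc n) → Fin n → Field.Carrier F) → Colored F cs M →
        Field._≈_ F (eval F g M) (Field.0# F) ⇔
        (∃ λ (i : Fin n) → ∃ λ (j : Fin n) →
          ¬ (i ≡ j) × _≈ᵛ_ F (column F M i) (column F M j)))
lemma2p6 F (suc m) (ℕ.s≤s ℕ.z≤n) cs palette =
  g m , g-degree m , λ M colored → mk⇔ (g≈0⇒collision cs M palette colored) (collision⇒g≈0 M)
  where
  open Polynomials F
  open Palettes F
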